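{- Let $\alpha,n\in\mathbb{Z}^+$ with $\alpha\mid n$ and $\beta=n/\alpha$. Then $|\mathcal{T}(\alpha,[n])|=|\mathcal{T}(\beta,[n])|$.
   Context: $[n]=\{1,\dots,n\}$. $A+B$ is the Minkowski sum. For finite $C\subset\mathbb{Z}$ and $\alpha\in\mathbb{Z}^+$, $\mathcal{T}(\alpha,C)$ is the set of pairs $(A,B)$ of finite subsets of $\mathbb{Z}$ with $A+B=C$, $|C|=|A||B|$, $|A|=\alpha$, $0\in B$ and $\min B\ge0$. -}

module Defs where

open import Data.Nat using (ℕ; _*_)
open import Data.Integer using (ℤ; +_; _+_; _≤_; _<_)
open import Data.List using (List; []; _∷_; length)
open import Data.List.Membership.Propositional using (_∈_)
open import Data.List.Relation.Unary.All using (All)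
open import Data.List.Relation.Unary.Unique.Propositional using (Unique)
open import Data.Product using (Σ; ∃; ∃-syntax; _×_)
open import Function.Bundles using (_⇔_)
open import Relation.Binary.PropositionalEquality using (_≡_)

-- A finite subset of ℤ is represented canonically by the strictly
-- increasing list of its elements (so distinct lists = distinct sets,
-- and the cardinality of the set is the length of the list).
data Increasing : List ℤ → Set where
  inc-[]  : Increasing []
  inc-one : ∀ x → Increasing (x ∷ [])
  inc-∷   : ∀ {x y xs} → x < y → Increasing (y ∷ xs) → Increasing (x ∷ y ∷ xs)

_∈Sum_,_ : ℤ → List ℤ → List ℤ → Set
c ∈Sum A , B = ∃[ a ] ∃[ b ] (a ∈ A × b ∈ B × c ≡ a + b)

_∈[_] : ℤ → ℕ → Set
c ∈[ n ] = (+ 1 ≤ c) × (c ≤ + n)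

𝒯 : ℕ → ℕ → List ℤ × List ℤ → Set
𝒯 α n (A Data.Product., B) =
  Increasing A × Increasing B
  × (∀ c → c ∈Sum A , B ⇔ c ∈[ n ])
  × (n ≡ length A * length B)
  × (length A ≡ α)
  × (+ 0 ∈ B)
  × All (λ b → + 0 ≤ b) B

HasCard : {X : Set} → (X → Set) → ℕ → Set
HasCard {X} P k = Σ (List X) λ xs → Unique xs × (∀ x → P x ⇔ x ∈ xs) × length xs ≡ k

-- The map (A, B) ↦ (B + 1, A − 1) is an involution exchanging the tilings of [n]
-- with |A| = α and those with |A| = β: shifting B up and A down by one keeps every
-- sum a + b, and A − 1 has minimum 0 because 1 ∈ A (write 1 = a + b with a ≥ 1,
-- b ≥ 0). Both sets are finite (all their members are short lists with entries in
-- {0, …, n}) and membership is decidable, so they have cardinalities, which the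
-- involution shows to be equal.
module Submission where

open import Defs
open import Data.Nat using (ℕ; _*_; _≤_)
open import Data.Nat.Divisibility using (_∣_)
open import Data.Product using (∃-syntax; _×_)
open import Relation.Binary.PropositionalEquality using (_≡_)

open import Data.Nat as ℕ using (zero; suc; s≤s; _<_; _∸_; _≟_)
import Data.Nat.Properties as ℕ
open import Data.Integer as ℤ using (ℤ; +_; +≤+)
import Data.Integer.Properties as ℤ
open import Data.Integer.Tactic.RingSolver using (solve-∀)
open import Data.List
  using (List; []; _∷_; length; map; filter; deduplicate; applyUpTo; cartesianProduct; cartesianProductWith)
import Data.List.Properties as List
open import Data.List.Membership.Propositional using (_∈_)
open import Data.List.Membership.Propositional.Properties
  using (∈-map⁺; ∈-map⁻; ∈-filter⁺; ∈-filter⁻; ∈-applyUpTo⁺; ∈-applyUpTo⁻;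
         ∈-cartesianProduct⁺; ∈-cartesianProductWith⁺; ∈-cartesianProductWith⁻; deduplicate-∈⇔)
open import Data.List.Membership.DecPropositional ℤ._≟_ using (_∈?_)
open import Data.List.Relation.Binary.Subset.DecPropositional ℤ._≟_ using (_⊆_; _⊆?_)
open import Data.List.Relation.Unary.All as All using (All; []; _∷_; all?)
import Data.List.Relation.Unary.All.Properties as All
open import Data.List.Relation.Unary.Any using (here; there)
import Data.List.Relation.Unary.Unique.Propositional.Properties as Unique
open import Data.List.Relation.Unary.Unique.DecPropositional.Properties using (deduplicate-!)
import Data.Product.Properties as Product
open import Data.Product using (_,_; proj₁; proj₂)
open import Function.Bundles using (_⇔_; mk⇔; Equivalence)
import Function.Properties.Equivalence as Equiv
open import Relation.Binary.Definitions using (DecidableEquality)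
open import Relation.Nullary using (Dec; yes; no)
open import Relation.Nullary.Decidable using (map′; _×-dec_)
open import Relation.Unary using (Decidable)
open import Relation.Binary.PropositionalEquality using (refl; sym; trans; cong; cong₂; subst; module ≡-Reasoning)

open Equivalence

module _ {X Y : Set} {P : X → Set} {Q : Y → Set} where

  HasCard-transport : (f : Y → X) (g : X → Y) →
                      (∀ x → f (g x) ≡ x) → (∀ y → g (f y) ≡ y) →
                      (∀ {x} → P x → Q (g x)) → (∀ {y} → Q y → P (f y)) →
                      ∀ {k} → HasCard P k → HasCard Q k
  HasCard-transport f g f∘g g∘f P⇒Q Q⇒P (xs , unique , P⇔∈ , |xs|≡k) =
    map g xs , Unique.map⁺ g-injective unique , Q⇔∈ , trans (List.length-map g xs) |xs|≡k
    where
    g-injective : ∀ {x x′} → g x ≡ g x′ → x ≡ x′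
    g-injective {x} {x′} eq = trans (sym (f∘g x)) (trans (cong f eq) (f∘g x′))

    Q⇔∈ : ∀ y → Q y ⇔ y ∈ map g xs
    Q⇔∈ y = mk⇔
      (λ Qy → subst (_∈ map g xs) (g∘f y) (∈-map⁺ g (to (P⇔∈ (f y)) (Q⇒P Qy))))
      (λ y∈ → case-∈-map y∈)
      where
      case-∈-map : y ∈ map g xs → Q y
      case-∈-map y∈ with x , x∈ , refl ← ∈-map⁻ g y∈ = P⇒Q (from (P⇔∈ x) x∈)

HasCard-filter : {X : Set} → DecidableEquality X → {P : X → Set} (P? : Decidable P) →
                 (xs : List X) → (∀ {x} → P x → x ∈ xs) → ∃[ k ] HasCard P k
HasCard-filter _≟_ {P} P? xs P⊆xs =
  _ , deduplicate _≟_ (filter P? xs) , deduplicate-! _≟_ _ , P⇔∈ , refl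
  where
  P⇔∈ : ∀ x → P x ⇔ x ∈ deduplicate _≟_ (filter P? xs)
  P⇔∈ x = mk⇔
    (λ Px → to (deduplicate-∈⇔ _≟_) (∈-filter⁺ P? (P⊆xs Px) Px))
    (λ x∈ → proj₂ (∈-filter⁻ P? {xs = xs} (from (deduplicate-∈⇔ _≟_) x∈)))

words : {A : Set} → ℕ → List A → List (List A)
words zero    xs = [] ∷ []
words (suc m) xs = [] ∷ cartesianProductWith _∷_ xs (words m xs)

∈-words : {A : Set} {xs : List A} (m : ℕ) (ws : List A) →
          length ws ≤ m → All (_∈ xs) ws → ws ∈ words m xs
∈-words zero    []       _         _          = here refl
∈-words (suc m) []       _         _          = here refl
∈-words (suc m) (w ∷ ws) (s≤s |ws|≤m) (w∈ ∷ ws⊆) =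
  there (∈-cartesianProductWith⁺ _∷_ w∈ (∈-words m ws |ws|≤m ws⊆))

m<n∸o⇒o+m<n : ∀ {m} n o → m < n ∸ o → o ℕ.+ m < n
m<n∸o⇒o+m<n n       zero    m<n   = m<n
m<n∸o⇒o+m<n zero    (suc o) ()
m<n∸o⇒o+m<n (suc n) (suc o) m<n∸o = s≤s (m<n∸o⇒o+m<n n o m<n∸o)

segment : ℕ → ℕ → List ℤ
segment k m = applyUpTo (λ i → + (k ℕ.+ i)) (suc m ∸ k)

∈-segment : ∀ {c} k m → c ∈ segment k m ⇔ (+ k ℤ.≤ c × c ℤ.≤ + m)
∈-segment {c} k m = mk⇔ bounded listed
  where
  bounded : c ∈ segment k m → + k ℤ.≤ c × c ℤ.≤ + m
  bounded c∈ with i , i< , refl ← ∈-applyUpTo⁻ (λ i → + (k ℕ.+ i)) c∈ =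
    +≤+ (ℕ.m≤m+n k i) , +≤+ (ℕ.<⇒≤pred (m<n∸o⇒o+m<n (suc m) k i<))

  listed : + k ℤ.≤ c × c ℤ.≤ + m → c ∈ segment k m
  listed (+≤+ {n = j} k≤j , +≤+ j≤m) =
    subst (_∈ segment k m) (cong +_ (ℕ.m+[n∸m]≡n k≤j))
      (∈-applyUpTo⁺ (λ i → + (k ℕ.+ i)) (ℕ.∸-monoˡ-< (s≤s j≤m) k≤j))

Increasing? : (xs : List ℤ) → Dec (Increasing xs)
Increasing? []           = yes inc-[]
Increasing? (x ∷ [])     = yes (inc-one x)
Increasing? (x ∷ y ∷ xs) with x ℤ.<? y | Increasing? (y ∷ xs)
... | yes x<y | yes ys↑ = yes (inc-∷ x<y ys↑)
... | no  x≮y | _       = no λ { (inc-∷ x<y _) → x≮y x<y }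
... | yes _   | no ¬ys↑ = no λ { (inc-∷ _ ys↑) → ¬ys↑ ys↑ }

Increasing-map : (f : ℤ → ℤ) → (∀ {x y} → x ℤ.< y → f x ℤ.< f y) →
                 ∀ {xs} → Increasing xs → Increasing (map f xs)
Increasing-map f f-mono inc-[]          = inc-[]
Increasing-map f f-mono (inc-one x)     = inc-one (f x)
Increasing-map f f-mono (inc-∷ x<y ys↑) = inc-∷ (f-mono x<y) (Increasing-map f f-mono ys↑)

∈Sum⇔∈cartesianProductWith : ∀ {c} A B → c ∈Sum A , B ⇔ c ∈ cartesianProductWith ℤ._+_ A B
∈Sum⇔∈cartesianProductWith A B = mk⇔
  (λ { (a , b , a∈ , b∈ , refl) → ∈-cartesianProductWith⁺ ℤ._+_ a∈ b∈ })
  (∈-cartesianProductWith⁻ ℤ._+_ A B)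

_⊕_≐[_] : List ℤ → List ℤ → ℕ → Set
A ⊕ B ≐[ n ] = ∀ c → c ∈Sum A , B ⇔ c ∈[ n ]

⊕≐[]⇔⊆×⊇ : ∀ A B n → A ⊕ B ≐[ n ] ⇔
           (cartesianProductWith ℤ._+_ A B ⊆ segment 1 n × segment 1 n ⊆ cartesianProductWith ℤ._+_ A B)
⊕≐[]⇔⊆×⊇ A B n = mk⇔
  (λ A⊕B≐ → (λ {c} c∈ → from (∈-segment 1 n) (to (A⊕B≐ c) (from sums c∈)))
           , (λ {c} c∈ → to sums (from (A⊕B≐ c) (to (∈-segment 1 n) c∈))))
  (λ (⊆ , ⊇) c → mk⇔ (λ c∈ → to (∈-segment 1 n) (⊆ (to sums c∈)))
                     (λ c∈ → from sums (⊇ (from (∈-segment 1 n) c∈))))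
  where
  sums : ∀ {c} → c ∈Sum A , B ⇔ c ∈ cartesianProductWith ℤ._+_ A B
  sums = ∈Sum⇔∈cartesianProductWith A B

_⊕_≐?[_] : ∀ A B n → Dec (A ⊕ B ≐[ n ])
A ⊕ B ≐?[ n ] = map′ (from (⊕≐[]⇔⊆×⊇ A B n)) (to (⊕≐[]⇔⊆×⊇ A B n))
  ((cartesianProductWith ℤ._+_ A B ⊆? segment 1 n) ×-dec (segment 1 n ⊆? cartesianProductWith ℤ._+_ A B))

𝒯? : ∀ α n → Decidable (𝒯 α n)
𝒯? α n (A , B) =
  Increasing? A ×-dec Increasing? B ×-dec A ⊕ B ≐?[ n ] ×-dec n ≟ length A * length B
  ×-dec length A ≟ α ×-dec + 0 ∈? B ×-dec all? (+ 0 ℤ.≤?_) B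

nonZero-length : {X : Set} {x : X} {xs : List X} → x ∈ xs → ℕ.NonZero (length xs)
nonZero-length {xs = _ ∷ _} _ = _

swap : List ℤ × List ℤ → List ℤ × List ℤ
swap (A , B) = map ℤ.suc B , map ℤ.pred A

swap-involutive : ∀ x → swap (swap x) ≡ x
swap-involutive (A , B) = cong₂ _,_ (map-inverse ℤ.suc-pred A) (map-inverse ℤ.pred-suc B)
  where
  map-inverse : ∀ {f g : ℤ → ℤ} → (∀ x → f (g x) ≡ x) → ∀ xs → map f (map g xs) ≡ xs
  map-inverse f∘g xs = trans (sym (List.map-∘ xs)) (trans (List.map-cong f∘g xs) (List.map-id xs))

∈Sum-swap : ∀ {c} A B → c ∈Sum A , B ⇔ c ∈Sum map ℤ.suc B , map ℤ.pred A
∈Sum-swap A B = mk⇔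
  (λ (a , b , a∈ , b∈ , c≡a+b) →
     ℤ.suc b , ℤ.pred a , ∈-map⁺ ℤ.suc b∈ , ∈-map⁺ ℤ.pred a∈ , trans c≡a+b (sym (suc+pred a b)))
  (λ (x , y , x∈ , y∈ , c≡x+y) → unshift x∈ y∈ c≡x+y)
  where
  -- ℤ.suc and ℤ.pred written out, as the ring solver does not unfold them.
  suc+pred : ∀ a b → (+ 1 ℤ.+ b) ℤ.+ (ℤ.- + 1 ℤ.+ a) ≡ a ℤ.+ b
  suc+pred = solve-∀

  unshift : ∀ {c x y} → x ∈ map ℤ.suc B → y ∈ map ℤ.pred A → c ≡ x ℤ.+ y → c ∈Sum A , B
  unshift x∈ y∈ c≡x+y with b , b∈ , refl ← ∈-map⁻ ℤ.suc x∈ | a , a∈ , refl ← ∈-map⁻ ℤ.pred y∈ =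
    a , b , a∈ , b∈ , trans c≡x+y (suc+pred a b)

module _ {A B : List ℤ} {n : ℕ} (A⊕B≐ : A ⊕ B ≐[ n ]) where

  ∈[]-left : + 0 ∈ B → ∀ {a} → a ∈ A → a ∈[ n ]
  ∈[]-left 0∈B {a} a∈ = subst (_∈[ n ]) (ℤ.+-identityʳ a) (to (A⊕B≐ _) (a , + 0 , a∈ , 0∈B , refl))

  1∈left : 1 ≤ n → + 0 ∈ B → All (+ 0 ℤ.≤_) B → + 1 ∈ A
  1∈left 1≤n 0∈B B≥0 with a , b , a∈ , b∈ , 1≡a+b ← from (A⊕B≐ (+ 1)) (ℤ.≤-refl , +≤+ 1≤n) =
    subst (_∈ A) (ℤ.≤-antisym a≤1 (proj₁ (∈[]-left 0∈B a∈))) a∈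
    where
    open ℤ.≤-Reasoning
    a≤1 : a ℤ.≤ + 1
    a≤1 = begin
      a          ≡⟨ ℤ.+-identityʳ a ⟨
      a ℤ.+ + 0  ≤⟨ ℤ.+-monoʳ-≤ a (All.lookup B≥0 b∈) ⟩
      a ℤ.+ b    ≡⟨ 1≡a+b ⟨
      + 1        ∎

  ≤-right : + 1 ∈ A → ∀ {b} → b ∈ B → b ℤ.≤ + n
  ≤-right 1∈A {b} b∈ = ℤ.≤-trans (ℤ.i≤suc[i] b) (proj₂ (to (A⊕B≐ _) (+ 1 , b , 1∈A , b∈ , refl)))

𝒯-swap : ∀ {α β n} → 1 ≤ n → α * β ≡ n → ∀ {x} → 𝒯 α n x → 𝒯 β n (swap x)
𝒯-swap {α} {β} {n} 1≤n αβ≡n {A , B} (A↑ , B↑ , A⊕B≐ , n≡|A||B| , |A|≡α , 0∈B , B≥0) =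
    Increasing-map ℤ.suc (ℤ.+-monoʳ-< (+ 1)) B↑
  , Increasing-map ℤ.pred (ℤ.+-monoʳ-< (ℤ.- + 1)) A↑
  , (λ c → Equiv.trans (Equiv.sym (∈Sum-swap A B)) (A⊕B≐ c))
  , n≡|B′||A′|
  , trans (List.length-map ℤ.suc B) |B|≡β
  , ∈-map⁺ ℤ.pred 1∈A
  , All.map⁺ (All.tabulate λ a∈ → ℤ.i<j⇒i≤pred[j] (ℤ.suc[i]≤j⇒i<j (proj₁ (∈[]-left A⊕B≐ 0∈B a∈))))
  where
  1∈A : + 1 ∈ A
  1∈A = 1∈left A⊕B≐ 1≤n 0∈B B≥0

  instance
    |A|≢0 : ℕ.NonZero (length A)
    |A|≢0 = nonZero-length 1∈A

  |B|≡β : length B ≡ β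
  |B|≡β = ℕ.*-cancelˡ-≡ (length B) β (length A) (begin
    length A * length B  ≡⟨ n≡|A||B| ⟨
    n                    ≡⟨ αβ≡n ⟨
    α * β                ≡⟨ cong (_* β) |A|≡α ⟨
    length A * β         ∎)
    where open ≡-Reasoning

  n≡|B′||A′| : n ≡ length (map ℤ.suc B) * length (map ℤ.pred A)
  n≡|B′||A′| = begin
    n                                            ≡⟨ n≡|A||B| ⟩
    length A * length B                          ≡⟨ ℕ.*-comm (length A) (length B) ⟩
    length B * length A                          ≡⟨ cong₂ _*_ (List.length-map ℤ.suc B) (List.length-map ℤ.pred A) ⟨
    length (map ℤ.suc B) * length (map ℤ.pred A) ∎
    where open ≡-Reasoning

𝒯⊆words : ∀ {α n} → 1 ≤ n → ∀ {x} → 𝒯 α n x →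
          x ∈ cartesianProduct (words n (segment 1 n)) (words n (segment 0 n))
𝒯⊆words {n = n} 1≤n {A , B} (_ , _ , A⊕B≐ , n≡|A||B| , _ , 0∈B , B≥0) =
  ∈-cartesianProduct⁺
    (∈-words n A |A|≤n (All.tabulate λ a∈ → from (∈-segment 1 n) (∈[]-left A⊕B≐ 0∈B a∈)))
    (∈-words n B |B|≤n (All.tabulate λ b∈ → from (∈-segment 0 n) (All.lookup B≥0 b∈ , ≤-right A⊕B≐ 1∈A b∈)))
  where
  1∈A : + 1 ∈ A
  1∈A = 1∈left A⊕B≐ 1≤n 0∈B B≥0

  |A|≤n : length A ≤ n
  |A|≤n = subst (length A ≤_) (sym n≡|A||B|) (ℕ.m≤m*n (length A) (length B) {{nonZero-length 0∈B}})

  |B|≤n : length B ≤ n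
  |B|≤n = subst (length B ≤_) (sym n≡|A||B|) (ℕ.m≤n*m (length B) (length A) {{nonZero-length 1∈A}})

𝒯-finite : ∀ α n → 1 ≤ n → ∃[ k ] HasCard (𝒯 α n) k
𝒯-finite α n 1≤n = HasCard-filter (Product.≡-dec (List.≡-dec ℤ._≟_) (List.≡-dec ℤ._≟_)) (𝒯? α n) _ (𝒯⊆words 1≤n)

corollary1 : (α n β : ℕ) → 1 ≤ α → 1 ≤ n → α ∣ n → β * α ≡ n →
    ∃[ k ] (HasCard (𝒯 α n) k × HasCard (𝒯 β n) k)
corollary1 α n β _ 1≤n _ βα≡n with k , card-α ← 𝒯-finite α n 1≤n =
  k , card-α , HasCard-transport swap swap swap-involutive swap-involutive
                 (𝒯-swap 1≤n αβ≡n) (𝒯-swap 1≤n βα≡n) card-α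
  where
  αβ≡n : α * β ≡ n
  αβ≡n = trans (ℕ.*-comm α β) βα≡n
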